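{- Let $Y$ be a profinite set (Boolean space), $Y^*$ the free monoid on $Y$, and $L\subseteq Y^*$. The following are equivalent: (a) there exists a continuous surjection $q\colon Y\twoheadrightarrow A$ onto a finite discrete set $A$ with $L=(q^*)^{ -1}(q^*[L])$, where $q^*\colon Y^*\to A^*$ is the length-preserving homomorphism extending $q$; (b) there is a partition of $Y$ into clopen sets $V_1,\dots,V_n$ such that for every $w\in L$ there is $f\colon\{1,\dots,|w|\}\to\{1,\dots,n\}$ with $w\in V_{f(1)}\cdots V_{f(|w|)}\subseteq L$; (c) there are clopen subsets $V_1,\dots,V_n$ of $Y$ such that for every $w\in L$ there is $f\colon\{1,\dots,|w|\}\to\{1,\dots,n\}$ with $w\in V_{f(1)}\cdots V_{f(|w|)}\subseteq L$.
   Context: $V_{f(1)}\cdots V_{f(k)}$ denotes the set of words $y_1\cdots y_k\in Y^*$ with $y_j\in V_{f(j)}$ for all $j$. -}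

module Defs where

open import Data.Bool using (Bool; true; false)
open import Data.Empty using (⊥)
open import Data.Unit using (⊤)
open import Data.Fin using (Fin)
open import Data.List using (List; []; _∷_; length; map; tabulate)
open import Data.Nat using (ℕ)
open import Data.Product using (Σ; ∃; ∃-syntax; _×_; _,_)
open import Relation.Nullary using (¬_)
open import Relation.Binary.PropositionalEquality using (_≡_)

Pred₀ : Set → Set₁
Pred₀ Y = Y → Set

_⊆_ : {Y : Set} → Pred₀ Y → Pred₀ Y → Set
P ⊆ Q = ∀ y → P y → Q y

record Topology (Y : Set) : Set₁ where
  field
    Open       : Pred₀ Y → Set
    open-ext   : ∀ {U W} → U ⊆ W → W ⊆ U → Open U → Open W
    open-univ  : Open (λ _ → ⊤)
    open-inter : ∀ {U W} → Open U → Open W → Open (λ y → U y × W y)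
    open-union : ∀ {I : Set} (U : I → Pred₀ Y) → (∀ i → Open (U i))
               → Open (λ y → Σ I (λ i → U i y))
open Topology public

-- Clopen subsets, represented by their characteristic maps Y → Bool
-- (= continuous maps to the discrete space Bool).
record Clopen {Y : Set} (T : Topology Y) : Set where
  field
    χ          : Y → Bool
    open-true  : Open T (λ y → χ y ≡ true)
    open-false : Open T (λ y → χ y ≡ false)
open Clopen public

_∈C_ : {Y : Set} {T : Topology Y} → Y → Clopen T → Set
y ∈C V = χ V y ≡ true

data _∈L_ {A : Set} (a : A) : List A → Set where
  here  : ∀ {xs} → a ∈L (a ∷ xs)
  there : ∀ {x xs} → a ∈L xs → a ∈L (x ∷ xs)

record IsBooleanSpace {Y : Set} (T : Topology Y) : Set₁ where
  field
    compact : ∀ {I : Set} (U : I → Pred₀ Y) → (∀ i → Open T (U i))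
            → (∀ y → ∃[ i ] U i y)
            → ∃[ is ] (∀ y → ∃[ i ] (i ∈L is × U i y))
    hausdorff : ∀ x y → ¬ x ≡ y →
      ∃[ U ] ∃[ W ] (Open T U × Open T W × U x × W y × (∀ z → U z → W z → ⊥))
    clopen-basis : ∀ (U : Pred₀ Y) → Open T U → ∀ y → U y →
      Σ (Clopen T) (λ V → y ∈C V × (∀ z → z ∈C V → U z))

Continuous : {Y : Set} → Topology Y → {k : ℕ} → (Y → Fin k) → Set
Continuous T {k} q = ∀ (a : Fin k) → Open T (λ y → q y ≡ a)

Surjective : {Y : Set} {k : ℕ} → (Y → Fin k) → Set
Surjective {Y} {k} q = ∀ (a : Fin k) → ∃[ y ] q y ≡ a

InProd : {Y : Set} {T : Topology Y} → List (Clopen T) → List Y → Set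
InProd []       []       = ⊤
InProd (V ∷ Vs) (y ∷ ys) = (y ∈C V) × InProd Vs ys
InProd []       (_ ∷ _)  = ⊥
InProd (_ ∷ _)  []       = ⊥

prodWord : {Y : Set} {T : Topology Y} {n : ℕ} (V : Fin n → Clopen T)
         (m : ℕ) → (Fin m → Fin n) → List (Clopen T)
prodWord V m f = tabulate {n = m} (λ i → V (f i))

CondA : {Y : Set} (T : Topology Y) → Pred₀ (List Y) → Set
CondA {Y} T L = ∃[ k ] Σ (Y → Fin k) (λ q →
  Continuous T q × Surjective q ×
  (∀ w → L w → ∃[ v ] (L v × map q v ≡ map q w)) ×
  (∀ w → (∃[ v ] (L v × map q v ≡ map q w)) → L w))

CoversL : {Y : Set} {T : Topology Y} {n : ℕ} → (Fin n → Clopen T) → Pred₀ (List Y) → Set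
CoversL {Y} {T} {n} V L = ∀ w → L w → Σ (Fin (length w) → Fin n) (λ f →
  InProd (prodWord V (length w) f) w ×
  (∀ u → InProd (prodWord V (length w) f) u → L u))

IsPartition : {Y : Set} {T : Topology Y} {n : ℕ} → (Fin n → Clopen T) → Set
IsPartition {Y} {T} {n} V =
  (∀ i → ∃[ y ] (y ∈C V i)) ×
  (∀ y → ∃[ i ] (y ∈C V i)) ×
  (∀ y i j → y ∈C V i → y ∈C V j → i ≡ j)

CondB : {Y : Set} (T : Topology Y) → Pred₀ (List Y) → Set
CondB T L = ∃[ n ] Σ (Fin n → Clopen T) (λ V → IsPartition V × CoversL V L)

CondC : {Y : Set} (T : Topology Y) → Pred₀ (List Y) → Set
CondC T L = ∃[ n ] Σ (Fin n → Clopen T) (λ V → CoversL V L)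

{-# OPTIONS --safe #-}
module Submission where

open import Defs
open import Axiom.UniquenessOfIdentityProofs using (module Decidable⇒UIP)
open import Data.Bool using (Bool; true; false)
import Data.Bool as Bool
open import Data.Fin using (Fin; zero; suc; _≟_)
open import Data.List using (List; []; _∷_; length; map; tabulate; lookup; deduplicate)
open import Data.List.Membership.Propositional using (_∈_)
open import Data.List.Membership.Propositional.Properties
  using (∈-lookup; ∈-map⁻; ∈-deduplicate⁺; ∈-deduplicate⁻)
import Data.List.Membership.Setoid.Properties as Membershipₛ
open import Data.List.Properties using (∷-injectiveˡ; ∷-injectiveʳ)
open import Data.List.Relation.Unary.Any using (here; there; index)
open import Data.List.Relation.Unary.Any.Properties using (lookup-index)
open import Data.List.Relation.Unary.Unique.Propositional using (Unique)
import Data.List.Relation.Unary.Unique.DecPropositional.Properties as UniqueProperties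
open import Data.Nat using (zero; suc)
open import Data.Product using (Σ; ∃-syntax; _×_; _,_; proj₁)
open import Data.Unit using (tt)
open import Data.Vec using (Vec; []; _∷_) renaming (tabulate to tabulateᵥ; lookup to lookupᵥ)
open import Data.Vec.Properties using (≡-dec; lookup∘tabulate) renaming (∷-injective to ∷-injectiveᵥ)
open import Function using (_∘_)
open import Function.Bundles using (_⇔_; mk⇔)
open import Relation.Binary.Definitions using (DecidableEquality)
open import Relation.Binary.PropositionalEquality
  using (_≡_; _≢_; refl; sym; trans; cong; cong₂; setoid)
open import Relation.Nullary using (Dec; yes; no; does; ¬_)
open import Relation.Nullary.Decidable using (dec-true; dec-false)

-- (a) ⇒ (b): the fibres of q partition Y into clopens, and a word w ∈ L lies in the product
-- of the fibres of its letters, every word of which has the same image under q* as w.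
-- (c) ⇒ (a): let q send y to its signature, the list of memberships y ∈ Vᵢ.  Level sets of
-- the signature are open, so by compactness it takes finitely many values, and q becomes a
-- continuous surjection onto a finite set.  Words with the same image under q* lie in the
-- same products V_{f(1)} ⋯ V_{f(m)}, so a saturating product for w ∈ L saturates L.

does-true⇒ : {P : Set} (P? : Dec P) → does P? ≡ true → P
does-true⇒ (yes p) _ = p

does-false⇒ : {P : Set} (P? : Dec P) → does P? ≡ false → ¬ P
does-false⇒ (no ¬p) _ = ¬p

∈L⇒∈-map : {A B : Set} (f : A → B) {b : B} {x : A} {xs : List A} →
           x ∈L xs → b ≡ f x → b ∈ map f xs
∈L⇒∈-map f here      b≡fx = here b≡fx
∈L⇒∈-map f (there p) b≡fx = there (∈L⇒∈-map f p b≡fx)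

index-∈-lookup : {A : Set} {xs : List A} (i : Fin (length xs)) → index (∈-lookup {xs = xs} i) ≡ i
index-∈-lookup {xs = _ ∷ _} zero    = refl
index-∈-lookup {xs = _ ∷ _} (suc i) = cong suc (index-∈-lookup i)

-- In a duplicate-free list over a type with decidable equality (hence a set, by Hedberg)
-- a membership proof is unique.
index-unique : {A : Set} → DecidableEquality A → {x : A} {xs : List A} → Unique xs →
               (x∈xs : x ∈ xs) (i : Fin (length xs)) → x ≡ lookup xs i → index x∈xs ≡ i
index-unique _≟ᴬ_ unique x∈xs i refl = trans
  (cong index (Membershipₛ.unique⇒irrelevant (setoid _) (Decidable⇒UIP.≡-irrelevant _≟ᴬ_)
                 unique x∈xs (∈-lookup i)))
  (index-∈-lookup i)

module FiniteImage {A B : Set} (_≟ᴮ_ : DecidableEquality B) (f : A → B) (xs : List A)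
                   (f∈ : ∀ a → f a ∈ map f xs) where

  values : List B
  values = deduplicate _≟ᴮ_ (map f xs)

  code : A → Fin (length values)
  code a = index (∈-deduplicate⁺ _≟ᴮ_ (f∈ a))

  decode : Fin (length values) → B
  decode = lookup values

  decode-code : ∀ a → decode (code a) ≡ f a
  decode-code a = sym (lookup-index (∈-deduplicate⁺ _≟ᴮ_ (f∈ a)))

  code-decode : ∀ a i → f a ≡ decode i → code a ≡ i
  code-decode a i = index-unique _≟ᴮ_ (UniqueProperties.deduplicate-! _≟ᴮ_ (map f xs))
                                  (∈-deduplicate⁺ _≟ᴮ_ (f∈ a)) i

  code-surjective : ∀ i → ∃[ a ] code a ≡ i
  code-surjective i with ∈-map⁻ f (∈-deduplicate⁻ _≟ᴮ_ (map f xs) (∈-lookup {xs = values} i))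
  ... | a , _ , decode-i≡fa = a , code-decode a i (sym decode-i≡fa)

module _ {Y : Set} (T : Topology Y) where

  fibre : ∀ {k} (q : Y → Fin k) → Continuous T q → Fin k → Clopen T
  fibre {k} q q-continuous a = record
    { χ          = λ y → does (q y ≟ a)
    ; open-true  = open-ext T (λ y → dec-true (q y ≟ a)) (λ y → does-true⇒ (q y ≟ a))
                     (q-continuous a)
    ; open-false = open-ext T other⇒false false⇒other
                     (open-union T (λ b y → q y ≡ proj₁ b) (q-continuous ∘ proj₁))
    }
    where
      other⇒false : ∀ y → Σ (Σ (Fin k) (_≢ a)) (λ b → q y ≡ proj₁ b) → does (q y ≟ a) ≡ false
      other⇒false y ((b , b≢a) , qy≡b) = dec-false (q y ≟ a) (b≢a ∘ trans (sym qy≡b))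
      false⇒other : ∀ y → does (q y ≟ a) ≡ false → Σ (Σ (Fin k) (_≢ a)) (λ b → q y ≡ proj₁ b)
      false⇒other y qy≢a = (q y , does-false⇒ (q y ≟ a) qy≢a) , refl

  signature : ∀ {n} → (Fin n → Clopen T) → Y → Vec Bool n
  signature V y = tabulateᵥ (λ i → χ (V i) y)

  signature-χ : ∀ {n} (V : Fin n → Clopen T) {y z} → signature V y ≡ signature V z →
                ∀ i → χ (V i) y ≡ χ (V i) z
  signature-χ V {y} {z} eq i = trans (sym (lookup∘tabulate (λ j → χ (V j) y) i))
                                     (trans (cong (λ s → lookupᵥ s i) eq)
                                            (lookup∘tabulate (λ j → χ (V j) z) i))

  open-χ : (V : Clopen T) (b : Bool) → Open T (λ y → χ V y ≡ b)
  open-χ V true  = open-true V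
  open-χ V false = open-false V

  open-signature : ∀ {n} (V : Fin n → Clopen T) (s : Vec Bool n) →
                   Open T (λ y → signature V y ≡ s)
  open-signature {zero} V [] = open-ext T (λ _ _ → refl) (λ _ _ → tt) (open-univ T)
  open-signature {suc n} V (b ∷ s) =
    open-ext T (λ _ (head≡ , tail≡) → cong₂ _∷_ head≡ tail≡) (λ _ → ∷-injectiveᵥ)
      (open-inter T (open-χ (V zero) b) (open-signature (V ∘ suc) s))

  compact⇒finite-image : IsBooleanSpace T → {B : Set} (f : Y → B) →
                         (∀ y → Open T (λ z → f z ≡ f y)) → ∃[ xs ] (∀ y → f y ∈ map f xs)
  compact⇒finite-image space f open-fibres
    with IsBooleanSpace.compact space (λ x z → f z ≡ f x) open-fibres (λ y → y , refl)
  ... | xs , covers = xs , λ y → let (_ , x∈xs , fy≡fx) = covers y in ∈L⇒∈-map f x∈xs fy≡fx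

  ∈-fibres : ∀ {k} (q : Y → Fin k) (q-continuous : Continuous T q) (w : List Y) →
             InProd (tabulate (fibre q q-continuous ∘ q ∘ lookup w)) w
  ∈-fibres q q-continuous []      = tt
  ∈-fibres q q-continuous (y ∷ w) = dec-true (q y ≟ q y) refl , ∈-fibres q q-continuous w

  ∈-fibres⇒map≡ : ∀ {k} (q : Y → Fin k) (q-continuous : Continuous T q) (w u : List Y) →
                  InProd (tabulate (fibre q q-continuous ∘ q ∘ lookup w)) u → map q u ≡ map q w
  ∈-fibres⇒map≡ q q-continuous []      []      _               = refl
  ∈-fibres⇒map≡ q q-continuous (y ∷ w) (x ∷ u) (x∈qy , u∈rest) =
    cong₂ _∷_ (does-true⇒ (q x ≟ q y) x∈qy) (∈-fibres⇒map≡ q q-continuous w u u∈rest)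

  InProd-resp-map : ∀ {n} (V : Fin n → Clopen T) {C : Set} (h : Y → C) →
                    (∀ {y z} → h y ≡ h z → ∀ i → χ (V i) y ≡ χ (V i) z) →
                    ∀ {m} (g : Fin m → Fin n) (v w : List Y) → map h v ≡ map h w →
                    InProd (prodWord V m g) v → InProd (prodWord V m g) w
  InProd-resp-map V h h-resp {zero}  g []      []      _      _ = tt
  InProd-resp-map V h h-resp {suc m} g (y ∷ v) (z ∷ w) hv≡hw (y∈ , v∈) =
    trans (sym (h-resp (∷-injectiveˡ hv≡hw) (g zero))) y∈
    , InProd-resp-map V h h-resp (g ∘ suc) v w (∷-injectiveʳ hv≡hw) v∈

  condA⇒condB : ∀ L → CondA T L → CondB T L
  condA⇒condB L (k , q , q-continuous , q-surjective , _ , saturated) =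
    k , V , (nonempty , covering , disjoint) , covers
    where
      V = fibre q q-continuous
      nonempty : ∀ a → ∃[ y ] (y ∈C V a)
      nonempty a = let (y , qy≡a) = q-surjective a in y , dec-true (q y ≟ a) qy≡a
      covering : ∀ y → ∃[ a ] (y ∈C V a)
      covering y = q y , dec-true (q y ≟ q y) refl
      disjoint : ∀ y a b → y ∈C V a → y ∈C V b → a ≡ b
      disjoint y a b y∈a y∈b = trans (sym (does-true⇒ (q y ≟ a) y∈a)) (does-true⇒ (q y ≟ b) y∈b)
      covers : CoversL V L
      covers w Lw = q ∘ lookup w , ∈-fibres q q-continuous w ,
        λ u u∈ → saturated u (w , Lw , sym (∈-fibres⇒map≡ q q-continuous w u u∈))

  condB⇒condC : ∀ L → CondB T L → CondC T L
  condB⇒condC L (n , V , _ , covers) = n , V , covers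

  condC⇒condA : IsBooleanSpace T → ∀ L → CondC T L → CondA T L
  condC⇒condA space L (n , V , covers)
    with compact⇒finite-image space (signature V) (open-signature V ∘ signature V)
  ... | xs , signature∈ =
    length values , code , code-continuous , code-surjective , (λ w Lw → w , Lw , refl) , saturated
    where
      open FiniteImage (≡-dec Bool._≟_) (signature V) xs signature∈
      code-continuous : Continuous T code
      code-continuous a = open-ext T (λ y → code-decode y a)
                            (λ y codey≡a → trans (sym (decode-code y)) (cong decode codey≡a))
                            (open-signature V (decode a))
      same-code⇒same-χ : ∀ {y z} → code y ≡ code z → ∀ i → χ (V i) y ≡ χ (V i) z
      same-code⇒same-χ {y} {z} codey≡codez = signature-χ V
        (trans (sym (decode-code y)) (trans (cong decode codey≡codez) (decode-code z)))
      saturated : ∀ w → ∃[ v ] (L v × map code v ≡ map code w) → L w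
      saturated w (v , Lv , v≈w) = let (f , v∈ , ⊆L) = covers v Lv in
        ⊆L w (InProd-resp-map V code same-code⇒same-χ f v w v≈w v∈)

proposition3p3 : (Y : Set) (T : Topology Y) → IsBooleanSpace T →
    (L : Pred₀ (List Y)) →
    (CondA T L ⇔ CondB T L) × (CondB T L ⇔ CondC T L)
proposition3p3 Y T space L =
    mk⇔ (condA⇒condB T L) (condC⇒condA T space L ∘ condB⇒condC T L)
  , mk⇔ (condB⇒condC T L) (condA⇒condB T L ∘ condC⇒condA T space L)
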